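{- Let $G$ be a $2$-edge-connected graph containing a non-separating cycle $C$. Suppose there is an edge subset $M \subseteq E(C)$ such that $G - M$ admits a nowhere-zero $4$-flow. Then $G$ has a $5$-CDC $\mathcal S$ with $C \in \mathcal S$.
   Context: Graphs are finite and may have parallel edges and loops. A cycle is a graph (here a subgraph of $G$) in which every vertex has even degree. A subgraph $C$ of a connected graph $H$ is non-separating if $H - E(C)$ is connected. A cycle double cover (CDC) of $G$ is a set of cycles of $G$ such that every edge of $G$ lies in the edge sets of exactly two of them; a $k$-CDC is a CDC consisting of $k$ cycles. -}

module Defs where

open import Data.Nat using (ℕ; zero; suc; _+_; _<_)
open import Data.Nat.Divisibility using (_∣_)
open import Data.Integer as ℤ using (ℤ; ∣_∣) renaming (_+_ to _+ℤ_; _-_ to _-ℤ_)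
open import Data.Fin using (Fin; zero; suc; _≟_)
open import Data.Bool using (Bool; true; false; if_then_else_; not)
open import Data.Product using (_×_; proj₁; proj₂; ∃)
open import Relation.Nullary.Decidable using (⌊_⌋)
open import Relation.Binary.PropositionalEquality using (_≡_)

-- A finite multigraph (parallel edges and loops allowed) with n vertices and
-- m edges; edge e has a fixed reference orientation  tail e → head e.
record Graph (n m : ℕ) : Set where
  field
    tail : Fin m → Fin n
    head : Fin m → Fin n
open Graph public

EdgeSet : ℕ → Set
EdgeSet m = Fin m → Bool

sumℕ : (m : ℕ) → (Fin m → ℕ) → ℕ
sumℕ zero    f = 0
sumℕ (suc m) f = f zero + sumℕ m (λ i → f (suc i))

sumℤ : (m : ℕ) → (Fin m → ℤ) → ℤ
sumℤ zero    f = ℤ.0ℤ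
sumℤ (suc m) f = f zero +ℤ sumℤ m (λ i → f (suc i))

module _ {n m : ℕ} (G : Graph n m) where

  -- degree of v in the spanning subgraph with edge set S (a loop counts twice)
  degree : EdgeSet m → Fin n → ℕ
  degree S v = sumℕ m (λ e → if S e
    then (if ⌊ tail G e ≟ v ⌋ then 1 else 0) + (if ⌊ head G e ≟ v ⌋ then 1 else 0)
    else 0)

  -- a cycle: a subgraph in which every vertex has even degree
  IsCycle : EdgeSet m → Set
  IsCycle S = ∀ v → 2 ∣ degree S v

  data Walk (A : EdgeSet m) : Fin n → Fin n → Set where
    [] : ∀ {v} → Walk A v v
    fwd : ∀ {w} (e : Fin m) → A e ≡ true → Walk A (head G e) w → Walk A (tail G e) w
    bwd : ∀ {w} (e : Fin m) → A e ≡ true → Walk A (tail G e) w → Walk A (head G e) w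

  ConnectedOn : EdgeSet m → Set
  ConnectedOn A = ∀ u v → Walk A u v

  Connected : Set
  Connected = ConnectedOn (λ _ → true)

  minus : EdgeSet m → EdgeSet m
  minus S e = not (S e)

  TwoEdgeConnected : Set
  TwoEdgeConnected = Connected × (∀ f → ConnectedOn (λ e → not ⌊ e ≟ f ⌋))

  NonSeparatingCycle : EdgeSet m → Set
  NonSeparatingCycle C = IsCycle C × ConnectedOn (minus C)

  netOut : EdgeSet m → (Fin m → ℤ) → Fin n → ℤ
  netOut A φ v = sumℤ m (λ e → if A e
    then (if ⌊ tail G e ≟ v ⌋ then φ e else ℤ.0ℤ) -ℤ (if ⌊ head G e ≟ v ⌋ then φ e else ℤ.0ℤ)
    else ℤ.0ℤ)

  NowhereZeroFlowOn : ℕ → EdgeSet m → Set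
  NowhereZeroFlowOn k A = ∃ λ (φ : Fin m → ℤ) →
    (∀ e → A e ≡ true → (0 < ∣ φ e ∣) × (∣ φ e ∣ < k)) ×
    (∀ v → netOut A φ v ≡ ℤ.0ℤ)

  IsCDC : (k : ℕ) → (Fin k → EdgeSet m) → Set
  IsCDC k 𝒮 = (∀ i → IsCycle (𝒮 i)) ×
    (∀ e → sumℕ k (λ i → if 𝒮 i e then 1 else 0) ≡ 2)

-- The edges on which the 4-flow φ of G − M is odd form an even subgraph D₁. Subtracting
-- from φ a ±1-flow on D₁ (an Eulerian orientation of D₁) leaves an even flow; half of it
-- is again a flow, whose odd edges form an even subgraph D₂. Every edge of G − M, hence
-- every edge off C, lies in D₁ ∪ D₂, the edges with φ = ±2 being caught by D₂. Let U be
-- the set of edges of C lying in neither. Since G − E(C) is connected it contains a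
-- T-join J for the odd vertices of U, so X = U △ J is even and meets C exactly in U.
-- Then C, X △ D₁ △ D₂ △ C, X △ D₁ △ C, X △ D₂ △ C and X are five cycles, and a check
-- edge by edge shows that they cover every edge exactly twice.
module Submission where

open import Defs
open import Algebra.Bundles using (CommutativeMonoid; CommutativeRing)
open import Data.Bool as Bool using (Bool; true; false; not; _∧_; _∨_; _xor_; if_then_else_)
open import Data.Bool.Properties
  using (xor-∧-commutativeRing; xor-assoc; xor-comm; xor-same; xor-identityʳ; not-involutive;
         not-distribˡ-xor; xor-annihilates-not; ¬-not; ∧-distribʳ-xor; ∧-zeroʳ; ∧-comm;
         ∧-conicalˡ; ∧-conicalʳ; ∧-assoc; ∧-distribˡ-xor; ∧-identityʳ)
open import Data.Fin using (Fin; zero; suc; _≟_)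
open import Data.Fin.Properties using (any?)
open import Data.Integer using (ℤ; +_; -[1+_]; ∣_∣; _⊖_; 0ℤ) renaming (_+_ to _+ℤ_; _-_ to _-ℤ_; -_ to -ℤ_)
open import Data.Nat as ℕ using (ℕ; zero; suc; _<_; s≤s; ⌊_/2⌋)
open import Data.Nat.Divisibility using (_∣_; divides)
open import Data.Product using (_×_; _,_; proj₁; proj₂; ∃)
import Data.Nat.Properties as ℕP
import Data.Integer.Properties as ℤP
open import Data.Integer.Tactic.RingSolver using (solve-∀)
open import Data.Vec.Functional as Vector using (Vector; updateAt; _∷_)
open import Data.Vec.Functional.Properties using (updateAt-updates; updateAt-minimal)
open import Function using (const; _∘_)
open import Relation.Binary.PropositionalEquality
  using (_≡_; _≢_; refl; sym; trans; cong; cong₂; ≡-≟-identity; ≢-≟-identity; module ≡-Reasoning)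
open import Relation.Nullary using (yes; no; contradiction)
open import Relation.Nullary.Decidable using (⌊_⌋)

module FiniteSum {c ℓ} (M : CommutativeMonoid c ℓ) where

  open CommutativeMonoid M
    using (Carrier; _≈_; _∙_; ε; setoid; ∙-cong; ∙-congˡ; identityˡ; identityʳ; assoc)
    renaming (refl to ≈-refl; sym to ≈-sym; trans to ≈-trans; reflexive to ≈-reflexive)
  open import Algebra.Properties.CommutativeMonoid.Sum M public
  open import Algebra.Solver.CommutativeMonoid M using (solve; _⊕_; _⊜_)
  open import Relation.Binary.Reasoning.Setoid setoid

  sum-zero : ∀ {n} (f : Vector Carrier n) → (∀ i → f i ≈ ε) → sum f ≈ ε
  sum-zero {zero}  f f≈ε = ≈-refl
  sum-zero {suc n} f f≈ε = ≈-trans (∙-cong (f≈ε zero) (sum-zero (f ∘ suc) (f≈ε ∘ suc))) (identityˡ ε)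

  sum-extract : ∀ {n} (f : Vector Carrier n) i → sum f ≈ f i ∙ sum (updateAt f i (const ε))
  sum-extract f zero    = ∙-congˡ (≈-sym (identityˡ _))
  sum-extract f (suc i) = begin
    f zero ∙ sum (f ∘ suc)                  ≈⟨ ∙-congˡ (sum-extract (f ∘ suc) i) ⟩
    f zero ∙ (f (suc i) ∙ R)                ≈⟨ solve 3 (λ x y z → x ⊕ (y ⊕ z) ⊜ y ⊕ (x ⊕ z)) ≈-refl _ _ R ⟩
    f (suc i) ∙ (f zero ∙ R)                ∎
    where R = sum (updateAt (f ∘ suc) i (const ε))

  sum-single : ∀ {n} (f : Vector Carrier n) i → (∀ j → j ≢ i → f j ≈ ε) → sum f ≈ f i
  sum-single f i f≈ε = begin
    sum f                               ≈⟨ sum-extract f i ⟩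
    f i ∙ sum (updateAt f i (const ε))  ≈⟨ ∙-congˡ (sum-zero _ vanishes) ⟩
    f i ∙ ε                             ≈⟨ identityʳ (f i) ⟩
    f i                                 ∎
    where
    vanishes : ∀ j → updateAt f i (const ε) j ≈ ε
    vanishes j with j ≟ i
    ... | yes refl = ≈-reflexive (updateAt-updates i f)
    ... | no j≢i   = ≈-trans (≈-reflexive (updateAt-minimal j i f j≢i)) (f≈ε j j≢i)

  sum-cong-except₂ : ∀ {n} (f g : Vector Carrier n) {i j} → i ≢ j →
    (∀ k → k ≢ i → k ≢ j → f k ≈ g k) → f i ∙ f j ≈ g i ∙ g j → sum f ≈ sum g
  sum-cong-except₂ f g {i} {j} i≢j f≈g pair = begin
    sum f                          ≈⟨ split f ⟩
    (f i ∙ f j) ∙ sum (rest f)     ≈⟨ ∙-cong pair (sum-cong-≋ rest-agree) ⟩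
    (g i ∙ g j) ∙ sum (rest g)     ≈⟨ split g ⟨
    sum g                          ∎
    where
    rest : Vector Carrier _ → Vector Carrier _
    rest h = updateAt (updateAt h i (const ε)) j (const ε)
    j≢i : j ≢ i
    j≢i = i≢j ∘ sym
    split : ∀ h → sum h ≈ (h i ∙ h j) ∙ sum (rest h)
    split h = begin
      sum h                                               ≈⟨ sum-extract h i ⟩
      h i ∙ sum (updateAt h i (const ε))                  ≈⟨ ∙-congˡ (sum-extract _ j) ⟩
      h i ∙ (updateAt h i (const ε) j ∙ sum (rest h))
        ≡⟨ cong (λ x → h i ∙ (x ∙ sum (rest h))) (updateAt-minimal j i h j≢i) ⟩
      h i ∙ (h j ∙ sum (rest h))                          ≈⟨ assoc (h i) (h j) _ ⟨
      (h i ∙ h j) ∙ sum (rest h)                          ∎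
    rest-at-i : ∀ h → rest h i ≡ ε
    rest-at-i h = trans (updateAt-minimal i j _ i≢j) (updateAt-updates i h)
    rest-at-j : ∀ h → rest h j ≡ ε
    rest-at-j h = updateAt-updates j _
    rest-at : ∀ h k → k ≢ i → k ≢ j → rest h k ≡ h k
    rest-at h k k≢i k≢j = trans (updateAt-minimal k j _ k≢j) (updateAt-minimal k i h k≢i)
    rest-agree : ∀ k → rest f k ≈ rest g k
    rest-agree k with k ≟ i | k ≟ j
    ... | yes refl | _        = ≈-reflexive (trans (rest-at-i f) (sym (rest-at-i g)))
    ... | no _     | yes refl = ≈-reflexive (trans (rest-at-j f) (sym (rest-at-j g)))
    ... | no k≢i   | no k≢j   = begin
      rest f k  ≡⟨ rest-at f k k≢i k≢j ⟩
      f k       ≈⟨ f≈g k k≢i k≢j ⟩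
      g k       ≡⟨ rest-at g k k≢i k≢j ⟨
      rest g k  ∎

module ∑₂ = FiniteSum (CommutativeRing.+-commutativeMonoid xor-∧-commutativeRing)
module ∑ℤ = FiniteSum ℤP.+-0-commutativeMonoid
module ∑ℕ = FiniteSum ℕP.+-0-commutativeMonoid

open import Algebra.Properties.Semiring.Sum (CommutativeRing.semiring xor-∧-commutativeRing)
  using () renaming (*-distribˡ-sum to ∧-distribˡ-∑₂; *-distribʳ-sum to ∧-distribʳ-∑₂)

∑₂-true⇒∃ : ∀ {k} (f : Fin k → Bool) → ∑₂.sum f ≡ true → ∃ λ i → f i ≡ true
∑₂-true⇒∃ f sum≡true with any? (λ i → f i Bool.≟ true)
... | yes found = found
... | no none   =
  contradiction (trans (sym sum≡true) (∑₂.sum-zero f (λ i → ¬-not (λ fi≡true → none (i , fi≡true))))) λ ()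

sumℤ≡∑ : ∀ k (f : Fin k → ℤ) → sumℤ k f ≡ ∑ℤ.sum f
sumℤ≡∑ zero    f = refl
sumℤ≡∑ (suc k) f = cong (f zero +ℤ_) (sumℤ≡∑ k (f ∘ suc))

xor-telescope : ∀ x y z → (x xor y) xor (y xor z) ≡ x xor z
xor-telescope x y z = begin
  (x xor y) xor (y xor z)  ≡⟨ xor-assoc x y (y xor z) ⟩
  x xor (y xor (y xor z))  ≡⟨ cong (x xor_) (xor-assoc y y z) ⟨
  x xor ((y xor y) xor z)  ≡⟨ cong (λ w → x xor (w xor z)) (xor-same y) ⟩
  x xor z                  ∎
  where open ≡-Reasoning

isOdd : ℕ → Bool
isOdd zero    = false
isOdd (suc n) = not (isOdd n)

isOdd-+ : ∀ m n → isOdd (m ℕ.+ n) ≡ isOdd m xor isOdd n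
isOdd-+ zero    n = refl
isOdd-+ (suc m) n = trans (cong not (isOdd-+ m n)) (not-distribˡ-xor (isOdd m) (isOdd n))

isOdd-sumℕ : ∀ k (f : Fin k → ℕ) → isOdd (sumℕ k f) ≡ ∑₂.sum (isOdd ∘ f)
isOdd-sumℕ zero    f = refl
isOdd-sumℕ (suc k) f = trans (isOdd-+ (f zero) _) (cong (isOdd (f zero) xor_) (isOdd-sumℕ k (f ∘ suc)))

even⇒2∣ : ∀ n → isOdd n ≡ false → 2 ∣ n
even⇒2∣ zero          _    = divides 0 refl
even⇒2∣ (suc (suc n)) even with even⇒2∣ n (trans (sym (not-involutive (isOdd n))) even)
... | divides q n≡q*2 = divides (suc q) (cong (λ k → suc (suc k)) n≡q*2)

2∣⇒even : ∀ n → 2 ∣ n → isOdd n ≡ false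
2∣⇒even _ (divides q refl) = double-even q
  where
  double-even : ∀ q → isOdd (q ℕ.* 2) ≡ false
  double-even zero    = refl
  double-even (suc q) = trans (not-involutive _) (double-even q)

even⇒⌊/2⌋+⌊/2⌋ : ∀ n → isOdd n ≡ false → ⌊ n /2⌋ ℕ.+ ⌊ n /2⌋ ≡ n
even⇒⌊/2⌋+⌊/2⌋ zero          _    = refl
even⇒⌊/2⌋+⌊/2⌋ (suc (suc n)) even = cong suc (trans (ℕP.+-suc ⌊ n /2⌋ ⌊ n /2⌋)
  (cong suc (even⇒⌊/2⌋+⌊/2⌋ n (trans (sym (not-involutive (isOdd n))) even))))

isOddℤ : ℤ → Bool
isOddℤ x = isOdd ∣ x ∣

isOddℤ-⊖ : ∀ m n → isOddℤ (m ⊖ n) ≡ isOdd m xor isOdd n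
isOddℤ-⊖ zero    zero    = refl
isOddℤ-⊖ zero    (suc n) = refl
isOddℤ-⊖ (suc m) zero    = sym (xor-identityʳ _)
isOddℤ-⊖ (suc m) (suc n) = begin
  isOddℤ (suc m ⊖ suc n)              ≡⟨ cong isOddℤ (ℤP.[1+m]⊖[1+n]≡m⊖n m n) ⟩
  isOddℤ (m ⊖ n)                      ≡⟨ isOddℤ-⊖ m n ⟩
  isOdd m xor isOdd n                 ≡⟨ xor-annihilates-not (isOdd m) (isOdd n) ⟨
  not (isOdd m) xor not (isOdd n)     ∎
  where open ≡-Reasoning

isOddℤ-+ : ∀ x y → isOddℤ (x +ℤ y) ≡ isOddℤ x xor isOddℤ y
isOddℤ-+ (+ m)    (+ n)    = isOdd-+ m n
isOddℤ-+ (+ m)    -[1+ n ] = isOddℤ-⊖ m (suc n)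
isOddℤ-+ -[1+ m ] (+ n)    = trans (isOddℤ-⊖ n (suc m)) (xor-comm (isOdd n) _)
isOddℤ-+ -[1+ m ] -[1+ n ] = begin
  not (isOdd (suc (m ℕ.+ n)))        ≡⟨ not-involutive _ ⟩
  isOdd (m ℕ.+ n)                    ≡⟨ isOdd-+ m n ⟩
  isOdd m xor isOdd n                ≡⟨ xor-annihilates-not (isOdd m) (isOdd n) ⟨
  not (isOdd m) xor not (isOdd n)    ∎
  where open ≡-Reasoning

isOddℤ-- : ∀ x y → isOddℤ (x -ℤ y) ≡ isOddℤ x xor isOddℤ y
isOddℤ-- x y = trans (isOddℤ-+ x (-ℤ y)) (cong (λ n → isOddℤ x xor isOdd n) (ℤP.∣-i∣≡∣i∣ y))

isOddℤ-sumℤ : ∀ k (f : Fin k → ℤ) → isOddℤ (sumℤ k f) ≡ ∑₂.sum (isOddℤ ∘ f)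
isOddℤ-sumℤ zero    f = refl
isOddℤ-sumℤ (suc k) f = trans (isOddℤ-+ (f zero) _) (cong (isOddℤ (f zero) xor_) (isOddℤ-sumℤ k (f ∘ suc)))

half : ℤ → ℤ
half (+ n)    = + ⌊ n /2⌋
half -[1+ n ] = -ℤ (+ ⌊ suc n /2⌋)

half+half : ∀ x → isOddℤ x ≡ false → half x +ℤ half x ≡ x
half+half (+ n)    even = cong +_ (even⇒⌊/2⌋+⌊/2⌋ n even)
half+half -[1+ n ] even = begin
  -ℤ (+ ⌊ suc n /2⌋) +ℤ -ℤ (+ ⌊ suc n /2⌋)  ≡⟨ ℤP.neg-distrib-+ (+ ⌊ suc n /2⌋) (+ ⌊ suc n /2⌋) ⟨
  -ℤ (+ (⌊ suc n /2⌋ ℕ.+ ⌊ suc n /2⌋))        ≡⟨ cong (λ k → -ℤ (+ k)) (even⇒⌊/2⌋+⌊/2⌋ (suc n) even) ⟩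
  -[1+ n ]                                       ∎
  where open ≡-Reasoning

x+x≡0⇒x≡0 : ∀ x → x +ℤ x ≡ 0ℤ → x ≡ 0ℤ
x+x≡0⇒x≡0 (+ n)    x+x≡0 = cong +_ (ℕP.m+n≡0⇒m≡0 n (ℤP.+-injective x+x≡0))
x+x≡0⇒x≡0 -[1+ n ] ()

isOddℤ-half-±2 : ∀ x → isOddℤ x ≡ false → 0 < ∣ x ∣ → ∣ x ∣ < 4 → isOddℤ (half x) ≡ true
isOddℤ-half-±2 (+ 2)    _ _ _ = refl
isOddℤ-half-±2 -[1+ 1 ] _ _ _ = refl
isOddℤ-half-±2 (+ 0)    _ () _
isOddℤ-half-±2 (+ 1)    () _ _
isOddℤ-half-±2 (+ 3)    () _ _
isOddℤ-half-±2 (+ suc (suc (suc (suc _)))) _ _ (s≤s (s≤s (s≤s (s≤s ()))))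
isOddℤ-half-±2 -[1+ 0 ] () _ _
isOddℤ-half-±2 -[1+ 2 ] () _ _
isOddℤ-half-±2 -[1+ suc (suc (suc _)) ] _ _ (s≤s (s≤s (s≤s (s≤s ()))))

⌊≟⌋-refl : ∀ {k} (x : Fin k) → ⌊ x ≟ x ⌋ ≡ true
⌊≟⌋-refl x = cong ⌊_⌋ (≡-≟-identity _≟_ refl)

⌊≟⌋-≢ : ∀ {k} {x y : Fin k} → x ≢ y → ⌊ x ≟ y ⌋ ≡ false
⌊≟⌋-≢ x≢y = cong ⌊_⌋ (≢-≟-identity _≟_ x≢y)

⌊≟⌋-true : ∀ {k} {x y : Fin k} → ⌊ x ≟ y ⌋ ≡ true → x ≡ y
⌊≟⌋-true {x = x} {y} x≟y with x ≟ y
... | yes x≡y = x≡y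

-- Even subgraphs

_△_ : ∀ {m} → EdgeSet m → EdgeSet m → EdgeSet m
(S △ T) e = S e xor T e

module _ {n m : ℕ} (G : Graph n m) where

  -- the number of ends of e at v, mod 2: false for a loop at v
  incident : Fin m → Fin n → Bool
  incident e v = ⌊ tail G e ≟ v ⌋ xor ⌊ head G e ≟ v ⌋

  oddDegree : EdgeSet m → Fin n → Bool
  oddDegree S v = ∑₂.sum (λ e → S e ∧ incident e v)

  IsEven : EdgeSet m → Set
  IsEven S = ∀ v → oddDegree S v ≡ false

  isOdd-degree : ∀ S v → isOdd (degree G S v) ≡ oddDegree S v
  isOdd-degree S v =
    trans (isOdd-sumℕ m _) (∑₂.sum-cong-≗ (λ e → summand (S e) ⌊ tail G e ≟ v ⌋ ⌊ head G e ≟ v ⌋))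
    where
    summand : ∀ s t h → isOdd (if s then (if t then 1 else 0) ℕ.+ (if h then 1 else 0) else 0) ≡ s ∧ (t xor h)
    summand false _     _     = refl
    summand true  true  true  = refl
    summand true  true  false = refl
    summand true  false true  = refl
    summand true  false false = refl

  cycle⇒even : ∀ {S} → IsCycle G S → IsEven S
  cycle⇒even {S} cycle v = trans (sym (isOdd-degree S v)) (2∣⇒even _ (cycle v))

  even⇒cycle : ∀ {S} → IsEven S → IsCycle G S
  even⇒cycle {S} even v = even⇒2∣ _ (trans (isOdd-degree S v) (even v))

  oddDegree-△ : ∀ S T v → oddDegree (S △ T) v ≡ oddDegree S v xor oddDegree T v
  oddDegree-△ S T v = trans (∑₂.sum-cong-≗ (λ e → ∧-distribʳ-xor (incident e v) (S e) (T e)))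
                            (∑₂.∑-distrib-+ (λ e → S e ∧ incident e v) (λ e → T e ∧ incident e v))

  even-△ : ∀ {S T} → IsEven S → IsEven T → IsEven (S △ T)
  even-△ {S} {T} S-even T-even v = trans (oddDegree-△ S T v) (cong₂ _xor_ (S-even v) (T-even v))

  oddDegree-toggle : ∀ e S v → oddDegree ((λ i → ⌊ i ≟ e ⌋) △ S) v ≡ incident e v xor oddDegree S v
  oddDegree-toggle e S v = trans (oddDegree-△ _ S v) (cong (_xor oddDegree S v) single)
    where
    single : oddDegree (λ i → ⌊ i ≟ e ⌋) v ≡ incident e v
    single = trans (∑₂.sum-single _ e (λ i i≢e → cong (_∧ incident i v) (⌊≟⌋-≢ i≢e)))
                   (cong (_∧ incident e v) (⌊≟⌋-refl e))

  handshake : ∀ S → ∑₂.sum (oddDegree S) ≡ false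
  handshake S = begin
    ∑₂.sum (λ v → ∑₂.sum (λ e → S e ∧ incident e v))
      ≡⟨ ∑₂.∑-comm (λ v e → S e ∧ incident e v) ⟩
    ∑₂.sum (λ e → ∑₂.sum (λ v → S e ∧ incident e v))
      ≡⟨ ∑₂.sum-cong-≗ (λ e → sym (∧-distribˡ-∑₂ (S e) (incident e))) ⟩
    ∑₂.sum (λ e → S e ∧ ∑₂.sum (incident e))
      ≡⟨ ∑₂.sum-zero _ (λ e → trans (cong (S e ∧_) (endpoints-cancel e)) (∧-zeroʳ (S e))) ⟩
    false
      ∎
    where
    open ≡-Reasoning
    point : ∀ x → ∑₂.sum (λ v → ⌊ x ≟ v ⌋) ≡ true
    point x = trans (∑₂.sum-single _ x (λ v v≢x → ⌊≟⌋-≢ (v≢x ∘ sym))) (⌊≟⌋-refl x)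
    endpoints-cancel : ∀ e → ∑₂.sum (incident e) ≡ false
    endpoints-cancel e = trans (∑₂.∑-distrib-+ (λ v → ⌊ tail G e ≟ v ⌋) (λ v → ⌊ head G e ≟ v ⌋))
                               (cong₂ _xor_ (point (tail G e)) (point (head G e)))

-- Flows

netOutTerm : Bool → Bool → Bool → ℤ → ℤ
netOutTerm a t h x = if a then (if t then x else 0ℤ) -ℤ (if h then x else 0ℤ) else 0ℤ

netOutTerm-+ : ∀ a t h x y → netOutTerm a t h (x +ℤ y) ≡ netOutTerm a t h x +ℤ netOutTerm a t h y
netOutTerm-+ false t h x y = refl
netOutTerm-+ true  t h x y = trans (cong₂ _-ℤ_ (if-+ t) (if-+ h))
  (interchange (if t then x else 0ℤ) (if t then y else 0ℤ) (if h then x else 0ℤ) (if h then y else 0ℤ))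
  where
  if-+ : ∀ b → (if b then x +ℤ y else 0ℤ) ≡ (if b then x else 0ℤ) +ℤ (if b then y else 0ℤ)
  if-+ false = refl
  if-+ true  = refl
  interchange : ∀ a b c d → (a +ℤ b) -ℤ (c +ℤ d) ≡ (a -ℤ c) +ℤ (b -ℤ d)
  interchange = solve-∀

netOutTerm-0 : ∀ a t h → netOutTerm a t h 0ℤ ≡ 0ℤ
netOutTerm-0 false t     h     = refl
netOutTerm-0 true  false false = refl
netOutTerm-0 true  false true  = refl
netOutTerm-0 true  true  false = refl
netOutTerm-0 true  true  true  = refl

isOddℤ-netOutTerm : ∀ a t h x → isOddℤ (netOutTerm a t h x) ≡ (a ∧ isOddℤ x) ∧ (t xor h)
isOddℤ-netOutTerm false t h x = refl
isOddℤ-netOutTerm true  t h x = begin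
  isOddℤ ((if t then x else 0ℤ) -ℤ (if h then x else 0ℤ))
    ≡⟨ isOddℤ-- (if t then x else 0ℤ) _ ⟩
  isOddℤ (if t then x else 0ℤ) xor isOddℤ (if h then x else 0ℤ)
    ≡⟨ cong₂ _xor_ (isOddℤ-if t) (isOddℤ-if h) ⟩
  (t ∧ isOddℤ x) xor (h ∧ isOddℤ x)
    ≡⟨ ∧-distribʳ-xor (isOddℤ x) t h ⟨
  (t xor h) ∧ isOddℤ x
    ≡⟨ ∧-comm (t xor h) (isOddℤ x) ⟩
  isOddℤ x ∧ (t xor h)
    ∎
  where
  open ≡-Reasoning
  isOddℤ-if : ∀ b → isOddℤ (if b then x else 0ℤ) ≡ b ∧ isOddℤ x
  isOddℤ-if false = refl
  isOddℤ-if true  = refl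

oddSupport : ∀ {m} → EdgeSet m → (Fin m → ℤ) → EdgeSet m
oddSupport A φ e = A e ∧ isOddℤ (φ e)

module _ {n m : ℕ} (G : Graph n m) where

  edgeOut : Bool → Fin n → Fin m → ℤ → ℤ
  edgeOut a v e = netOutTerm a ⌊ tail G e ≟ v ⌋ ⌊ head G e ≟ v ⌋

  IsFlow : EdgeSet m → (Fin m → ℤ) → Set
  IsFlow A φ = ∀ v → netOut G A φ v ≡ 0ℤ

  netOut≡∑ : ∀ A φ v → netOut G A φ v ≡ ∑ℤ.sum (λ e → edgeOut (A e) v e (φ e))
  netOut≡∑ A φ v = sumℤ≡∑ m _

  netOut-+ : ∀ A φ ψ v → netOut G A (λ e → φ e +ℤ ψ e) v ≡ netOut G A φ v +ℤ netOut G A ψ v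
  netOut-+ A φ ψ v = begin
    netOut G A (λ e → φ e +ℤ ψ e) v
      ≡⟨ netOut≡∑ A _ v ⟩
    ∑ℤ.sum (λ e → edgeOut (A e) v e (φ e +ℤ ψ e))
      ≡⟨ ∑ℤ.sum-cong-≗ (λ e → netOutTerm-+ (A e) ⌊ tail G e ≟ v ⌋ ⌊ head G e ≟ v ⌋ (φ e) (ψ e)) ⟩
    ∑ℤ.sum (λ e → edgeOut (A e) v e (φ e) +ℤ edgeOut (A e) v e (ψ e))
      ≡⟨ ∑ℤ.∑-distrib-+ (λ e → edgeOut (A e) v e (φ e)) (λ e → edgeOut (A e) v e (ψ e)) ⟩
    ∑ℤ.sum (λ e → edgeOut (A e) v e (φ e)) +ℤ ∑ℤ.sum (λ e → edgeOut (A e) v e (ψ e))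
      ≡⟨ cong₂ _+ℤ_ (netOut≡∑ A φ v) (netOut≡∑ A ψ v) ⟨
    netOut G A φ v +ℤ netOut G A ψ v ∎
    where open ≡-Reasoning

  netOut-cong : ∀ A {φ ψ} → (∀ e → A e ≡ true → φ e ≡ ψ e) → ∀ v → netOut G A φ v ≡ netOut G A ψ v
  netOut-cong A {φ} {ψ} φ≡ψ v = trans (netOut≡∑ A φ v) (trans (∑ℤ.sum-cong-≗ term-cong) (sym (netOut≡∑ A ψ v)))
    where
    term-cong : ∀ e → edgeOut (A e) v e (φ e) ≡ edgeOut (A e) v e (ψ e)
    term-cong e with A e in Ae
    ... | true  = cong (edgeOut true v e) (φ≡ψ e Ae)
    ... | false = refl

  netOut-restrict : ∀ A D s → (∀ e → D e ≡ true → A e ≡ true) →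
    ∀ v → netOut G A (λ e → if D e then s e else 0ℤ) v ≡ netOut G D s v
  netOut-restrict A D s D⊆A v = trans (netOut≡∑ A _ v) (trans (∑ℤ.sum-cong-≗ term-restrict) (sym (netOut≡∑ D s v)))
    where
    term-restrict : ∀ e → edgeOut (A e) v e (if D e then s e else 0ℤ) ≡ edgeOut (D e) v e (s e)
    term-restrict e with D e in De
    ... | true  rewrite D⊆A e De = refl
    ... | false = netOutTerm-0 (A e) ⌊ tail G e ≟ v ⌋ ⌊ head G e ≟ v ⌋

  isOddℤ-netOut : ∀ A φ v → isOddℤ (netOut G A φ v) ≡ oddDegree G (oddSupport A φ) v
  isOddℤ-netOut A φ v = trans (isOddℤ-sumℤ m _)
    (∑₂.sum-cong-≗ (λ e → isOddℤ-netOutTerm (A e) ⌊ tail G e ≟ v ⌋ ⌊ head G e ≟ v ⌋ (φ e)))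

  oddSupport-even : ∀ A φ → IsFlow A φ → IsEven G (oddSupport A φ)
  oddSupport-even A φ flow v = trans (sym (isOddℤ-netOut A φ v)) (cong isOddℤ (flow v))

-- Eulerian orientations

size : ∀ {m} → EdgeSet m → ℕ
size D = ∑ℕ.sum (λ e → if D e then 1 else 0)

remove : ∀ {m} → Fin m → EdgeSet m → EdgeSet m
remove e D = updateAt D e (const false)

size-remove : ∀ {m} (D : EdgeSet m) {e} → D e ≡ true → size D ≡ suc (size (remove e D))
size-remove D {e} D∋e = begin
  size D
    ≡⟨ ∑ℕ.sum-extract (λ i → if D i then 1 else 0) e ⟩
  (if D e then 1 else 0) ℕ.+ ∑ℕ.sum (updateAt (λ i → if D i then 1 else 0) e (const 0))
    ≡⟨ cong₂ ℕ._+_ (cong (λ b → if b then 1 else 0) D∋e) (∑ℕ.sum-cong-≗ agree) ⟩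
  suc (size (remove e D))
    ∎
  where
  open ≡-Reasoning
  agree : ∀ i → updateAt (λ i → if D i then 1 else 0) e (const 0) i ≡ (if remove e D i then 1 else 0)
  agree i with i ≟ e
  ... | yes refl = trans (updateAt-updates e _) (cong (λ b → if b then 1 else 0) (sym (updateAt-updates e D)))
  ... | no i≢e   =
    trans (updateAt-minimal i e _ i≢e) (cong (λ b → if b then 1 else 0) (sym (updateAt-minimal i e D i≢e)))

size≡0⇒empty : ∀ {m} (D : EdgeSet m) → size D ≡ 0 → ∀ e → D e ≡ false
size≡0⇒empty D size≡0 e = ¬-not (λ D∋e → ℕP.0≢1+n (trans (sym size≡0) (size-remove D D∋e)))

size≡suc⇒nonempty : ∀ {m k} (D : EdgeSet m) → size D ≡ suc k → ∃ λ e → D e ≡ true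
size≡suc⇒nonempty D size≡1+k with any? (λ e → D e Bool.≟ true)
... | yes found = found
... | no none   = contradiction (trans (sym size≡1+k) (∑ℕ.sum-zero _ vanishes)) λ ()
  where
  vanishes : ∀ e → (if D e then 1 else 0) ≡ 0
  vanishes e = cong (λ b → if b then 1 else 0) (¬-not (λ D∋e → none (e , D∋e)))

sgn : Bool → ℤ
sgn true  = + 1
sgn false = -[1+ 0 ]

isOddℤ-sgn : ∀ b → isOddℤ (sgn b) ≡ true
isOddℤ-sgn true  = refl
isOddℤ-sgn false = refl

HasEulerianOrientation : ∀ {n m} → Graph n m → EdgeSet m → Set
HasEulerianOrientation {m = m} G D = ∃ λ (σ : Fin m → Bool) → IsFlow G D (sgn ∘ σ)

δ : ∀ {n} → Fin n → Fin n → ℤ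
δ x w = if ⌊ x ≟ w ⌋ then + 1 else 0ℤ

arc : ∀ {n} → Fin n → Fin n → Fin n → ℤ
arc x y w = δ x w -ℤ δ y w

arc-if : ∀ {n} (x y w : Fin n) s →
  arc (if s then x else y) (if s then y else x) w ≡ (if s then arc x y w else arc y x w)
arc-if x y w true  = refl
arc-if x y w false = refl

arc-if-not : ∀ {n} (x y w : Fin n) s →
  arc (if not s then x else y) (if not s then y else x) w ≡ (if s then arc y x w else arc x y w)
arc-if-not x y w true  = refl
arc-if-not x y w false = refl

arc-telescope : ∀ {n} (x y z w : Fin n) → arc x y w +ℤ arc y z w ≡ arc x z w +ℤ 0ℤ
arc-telescope x y z w = trans (ℤP.+-minus-telescope (δ x w) (δ y w) (δ z w)) (sym (ℤP.+-identityʳ (arc x z w)))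

module _ {n m : ℕ} (G : Graph n m) where

  arcAlong : Fin m → Bool → Fin n → ℤ
  arcAlong e forward = arc (if forward then tail G e else head G e) (if forward then head G e else tail G e)

  arcsOut : EdgeSet m → (Fin m → Bool) → Fin n → Fin m → ℤ
  arcsOut D σ w e = if D e then arcAlong e (σ e) w else 0ℤ

  netOut-orientation : ∀ D σ w → netOut G D (sgn ∘ σ) w ≡ ∑ℤ.sum (arcsOut D σ w)
  netOut-orientation D σ w = trans (netOut≡∑ G D (sgn ∘ σ) w) (∑ℤ.sum-cong-≗ term)
    where
    backward : ∀ t h → (if t then -[1+ 0 ] else 0ℤ) -ℤ (if h then -[1+ 0 ] else 0ℤ)
                       ≡ (if h then + 1 else 0ℤ) -ℤ (if t then + 1 else 0ℤ)
    backward false false = refl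
    backward false true  = refl
    backward true  false = refl
    backward true  true  = refl
    term : ∀ e → edgeOut G (D e) w e (sgn (σ e)) ≡ arcsOut D σ w e
    term e with D e | σ e
    ... | false | _     = refl
    ... | true  | true  = refl
    ... | true  | false = backward ⌊ tail G e ≟ w ⌋ ⌊ head G e ≟ w ⌋

  other : Fin m → Fin n → Fin n
  other e u = if ⌊ tail G e ≟ u ⌋ then head G e else tail G e

  incident-other : ∀ {e u} → incident G e u ≡ true → ∀ w →
    incident G e w ≡ ⌊ u ≟ w ⌋ xor ⌊ other e u ≟ w ⌋
  incident-other {e} {u} e∋u w with tail G e ≟ u
  ... | yes refl = refl
  ... | no _ rewrite ⌊≟⌋-true e∋u = xor-comm ⌊ tail G e ≟ w ⌋ ⌊ u ≟ w ⌋

  arcAlong-from : ∀ {e u} → incident G e u ≡ true → ∀ s w →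
    arcAlong e (if ⌊ tail G e ≟ u ⌋ then s else not s) w ≡ (if s then arc u (other e u) w else arc (other e u) u w)
  arcAlong-from {e} {u} e∋u s w with tail G e ≟ u
  ... | yes refl = arc-if (tail G e) (head G e) w s
  ... | no _ rewrite ⌊≟⌋-true e∋u = arc-if-not (tail G e) u w s

  arcAlong-loop : ∀ {e} → tail G e ≡ head G e → ∀ forward w → arcAlong e forward w ≡ 0ℤ
  arcAlong-loop {e} loop true  w rewrite loop = ℤP.+-inverseʳ (δ (head G e) w)
  arcAlong-loop {e} loop false w rewrite loop = ℤP.+-inverseʳ (δ (head G e) w)

  module _ {D : EdgeSet m} {e : Fin m} (loop : tail G e ≡ head G e) where

    even-remove-loop : IsEven G D → IsEven G (remove e D)
    even-remove-loop D-even v = trans (∑₂.sum-cong-≗ summand) (D-even v)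
      where
      summand : ∀ i → remove e D i ∧ incident G i v ≡ D i ∧ incident G i v
      summand i with i ≟ e
      ... | no i≢e   = cong (_∧ incident G i v) (updateAt-minimal i e D i≢e)
      ... | yes refl = begin
        remove e D e ∧ incident G e v  ≡⟨ cong (_∧ incident G e v) (updateAt-updates e D) ⟩
        false                          ≡⟨ ∧-zeroʳ (D e) ⟨
        D e ∧ false                    ≡⟨ cong (D e ∧_) (xor-same ⌊ head G e ≟ v ⌋) ⟨
        D e ∧ (⌊ head G e ≟ v ⌋ xor ⌊ head G e ≟ v ⌋)
                                       ≡⟨ cong (λ x → D e ∧ (⌊ x ≟ v ⌋ xor ⌊ head G e ≟ v ⌋)) loop ⟨
        D e ∧ incident G e v           ∎
        where open ≡-Reasoning

    orientation-remove-loop : HasEulerianOrientation G (remove e D) → HasEulerianOrientation G D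
    orientation-remove-loop (σ , flow) = σ , λ w → begin
      netOut G D (sgn ∘ σ) w                  ≡⟨ netOut-orientation D σ w ⟩
      ∑ℤ.sum (arcsOut D σ w)                  ≡⟨ ∑ℤ.sum-cong-≗ (summand w) ⟩
      ∑ℤ.sum (arcsOut (remove e D) σ w)       ≡⟨ netOut-orientation (remove e D) σ w ⟨
      netOut G (remove e D) (sgn ∘ σ) w       ≡⟨ flow w ⟩
      0ℤ                                      ∎
      where
      open ≡-Reasoning
      summand : ∀ w i → arcsOut D σ w i ≡ arcsOut (remove e D) σ w i
      summand w i with i ≟ e
      ... | no i≢e   = cong (λ d → if d then arcAlong i (σ i) w else 0ℤ) (sym (updateAt-minimal i e D i≢e))
      ... | yes refl with D e
      ...   | false = sym (cong (λ d → if d then arcAlong e (σ e) w else 0ℤ) (updateAt-updates e D))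
      ...   | true  = trans (arcAlong-loop loop (σ e) w)
                        (sym (cong (λ d → if d then arcAlong e (σ e) w else 0ℤ) (updateAt-updates e D)))

  second-edge-at-tail : ∀ {D e₁} → IsEven G D → D e₁ ≡ true → tail G e₁ ≢ head G e₁ →
    ∃ λ e₂ → e₂ ≢ e₁ × D e₂ ≡ true × incident G e₂ (tail G e₁) ≡ true
  second-edge-at-tail {D} {e₁} D-even D∋e₁ ¬loop =
    e₂ , e₂≢e₁ , ∧-conicalˡ _ _ f∋e₂ , ∧-conicalʳ _ _ f∋e₂
    where
    u = tail G e₁
    f : Fin m → Bool
    f i = D i ∧ incident G i u
    rest : Fin m → Bool
    rest = updateAt f e₁ (const false)
    f∋e₁ : f e₁ ≡ true
    f∋e₁ rewrite D∋e₁ | ⌊≟⌋-refl u | ⌊≟⌋-≢ (¬loop ∘ sym) = refl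
    rest-odd : ∑₂.sum rest ≡ true
    rest-odd = begin
      ∑₂.sum rest                  ≡⟨ not-involutive _ ⟨
      not (not (∑₂.sum rest))      ≡⟨ cong (λ x → not (x xor ∑₂.sum rest)) f∋e₁ ⟨
      not (f e₁ xor ∑₂.sum rest)   ≡⟨ cong not (∑₂.sum-extract f e₁) ⟨
      not (∑₂.sum f)               ≡⟨ cong not (D-even u) ⟩
      true                         ∎
      where open ≡-Reasoning
    found : ∃ λ i → rest i ≡ true
    found = ∑₂-true⇒∃ rest rest-odd
    e₂ = proj₁ found
    e₂≢e₁ : e₂ ≢ e₁
    e₂≢e₁ e₂≡e₁ =
      contradiction (trans (sym (proj₂ found)) (trans (cong rest e₂≡e₁) (updateAt-updates e₁ f))) λ ()
    f∋e₂ : f e₂ ≡ true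
    f∋e₂ = trans (sym (updateAt-minimal e₂ e₁ f e₂≢e₁)) (proj₂ found)

-- Splitting off e₁ = ua and e₂ = ub at u reroutes e₁ to ab and drops e₂; an Eulerian
-- orientation of the result lifts back by orienting e₁, e₂ as a path from a to b through u.
module SplitOff {n m : ℕ} (G : Graph n m) (D : EdgeSet m) {e₁ e₂ : Fin m} (e₂≢e₁ : e₂ ≢ e₁)
  (D∋e₁ : D e₁ ≡ true) (D∋e₂ : D e₂ ≡ true) (e₂∋u : incident G e₂ (tail G e₁) ≡ true) where

  u a b : Fin n
  u = tail G e₁
  a = head G e₁
  b = other G e₂ u

  G′ : Graph n m
  G′ = record { tail = updateAt (tail G) e₁ (const a) ; head = updateAt (head G) e₁ (const b) }

  D′ : EdgeSet m
  D′ = remove e₂ D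

  private
    e₁≢e₂ : e₁ ≢ e₂
    e₁≢e₂ = e₂≢e₁ ∘ sym

    D′∋e₁ : D′ e₁ ≡ true
    D′∋e₁ = trans (updateAt-minimal e₁ e₂ D e₁≢e₂) D∋e₁

    D′∌e₂ : D′ e₂ ≡ false
    D′∌e₂ = updateAt-updates e₂ D

    tail′-off : ∀ {k} → k ≢ e₁ → tail G′ k ≡ tail G k
    tail′-off k≢e₁ = updateAt-minimal _ e₁ (tail G) k≢e₁

    head′-off : ∀ {k} → k ≢ e₁ → head G′ k ≡ head G k
    head′-off k≢e₁ = updateAt-minimal _ e₁ (head G) k≢e₁

    D′-off : ∀ {k} → k ≢ e₂ → D′ k ≡ D k
    D′-off k≢e₂ = updateAt-minimal _ e₂ D k≢e₂

  even : IsEven G D → IsEven G′ D′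
  even D-even w = trans (∑₂.sum-cong-except₂ _ _ e₁≢e₂ off pair) (D-even w)
    where
    off : ∀ k → k ≢ e₁ → k ≢ e₂ → D′ k ∧ incident G′ k w ≡ D k ∧ incident G k w
    off k k≢e₁ k≢e₂ rewrite tail′-off k≢e₁ | head′-off k≢e₁ | D′-off k≢e₂ = refl
    pair : (D′ e₁ ∧ incident G′ e₁ w) xor (D′ e₂ ∧ incident G′ e₂ w)
         ≡ (D e₁ ∧ incident G e₁ w) xor (D e₂ ∧ incident G e₂ w)
    pair rewrite D′∋e₁ | D′∌e₂ | D∋e₁ | D∋e₂ | updateAt-updates e₁ {const a} (tail G)
               | updateAt-updates e₁ {const b} (head G) | incident-other G e₂∋u w = begin
      (⌊ a ≟ w ⌋ xor ⌊ b ≟ w ⌋) xor false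
        ≡⟨ xor-identityʳ _ ⟩
      ⌊ a ≟ w ⌋ xor ⌊ b ≟ w ⌋
        ≡⟨ xor-telescope ⌊ a ≟ w ⌋ ⌊ u ≟ w ⌋ ⌊ b ≟ w ⌋ ⟨
      (⌊ a ≟ w ⌋ xor ⌊ u ≟ w ⌋) xor (⌊ u ≟ w ⌋ xor ⌊ b ≟ w ⌋)
        ≡⟨ cong (_xor (⌊ u ≟ w ⌋ xor ⌊ b ≟ w ⌋)) (xor-comm ⌊ a ≟ w ⌋ ⌊ u ≟ w ⌋) ⟩
      (⌊ u ≟ w ⌋ xor ⌊ a ≟ w ⌋) xor (⌊ u ≟ w ⌋ xor ⌊ b ≟ w ⌋)
        ∎
      where open ≡-Reasoning

  lift : HasEulerianOrientation G′ D′ → HasEulerianOrientation G D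
  lift (σ′ , flow′) = σ , λ w → begin
    netOut G D (sgn ∘ σ) w        ≡⟨ netOut-orientation G D σ w ⟩
    ∑ℤ.sum (arcsOut G D σ w)      ≡⟨ ∑ℤ.sum-cong-except₂ _ _ e₁≢e₂ (off w) (pair w) ⟩
    ∑ℤ.sum (arcsOut G′ D′ σ′ w)   ≡⟨ netOut-orientation G′ D′ σ′ w ⟨
    netOut G′ D′ (sgn ∘ σ′) w     ≡⟨ flow′ w ⟩
    0ℤ                            ∎
    where
    open ≡-Reasoning
    s = σ′ e₁
    σ : Fin m → Bool
    σ = updateAt (updateAt σ′ e₁ (const (not s))) e₂ (const (if ⌊ tail G e₂ ≟ u ⌋ then s else not s))
    σ-off : ∀ {k} → k ≢ e₁ → k ≢ e₂ → σ k ≡ σ′ k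
    σ-off {k} k≢e₁ k≢e₂ = trans (updateAt-minimal k e₂ _ k≢e₂) (updateAt-minimal k e₁ σ′ k≢e₁)
    σ-e₁ : σ e₁ ≡ not s
    σ-e₁ = trans (updateAt-minimal e₁ e₂ _ e₁≢e₂) (updateAt-updates e₁ σ′)
    σ-e₂ : σ e₂ ≡ (if ⌊ tail G e₂ ≟ u ⌋ then s else not s)
    σ-e₂ = updateAt-updates e₂ _
    off : ∀ w k → k ≢ e₁ → k ≢ e₂ → arcsOut G D σ w k ≡ arcsOut G′ D′ σ′ w k
    off w k k≢e₁ k≢e₂ rewrite tail′-off k≢e₁ | head′-off k≢e₁ | D′-off k≢e₂ | σ-off k≢e₁ k≢e₂ = refl
    pair : ∀ w → arcsOut G D σ w e₁ +ℤ arcsOut G D σ w e₂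
               ≡ arcsOut G′ D′ σ′ w e₁ +ℤ arcsOut G′ D′ σ′ w e₂
    pair w rewrite D∋e₁ | D∋e₂ | D′∋e₁ | D′∌e₂
                 | σ-e₁ | σ-e₂
                 | updateAt-updates e₁ {const a} (tail G) | updateAt-updates e₁ {const b} (head G)
                 | arc-if-not u a w s | arcAlong-from G e₂∋u s w | arc-if a b w s = telescope s
      where
      telescope : ∀ s → (if s then arc a u w else arc u a w) +ℤ (if s then arc u b w else arc b u w)
                      ≡ (if s then arc a b w else arc b a w) +ℤ 0ℤ
      telescope true  = arc-telescope a u b w
      telescope false = trans (ℤP.+-comm (arc u a w) (arc b u w)) (arc-telescope b u a w)

eulerian-orientation-of-size : ∀ k {n m} (G : Graph n m) (D : EdgeSet m) → size D ≡ k → IsEven G D →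
  HasEulerianOrientation G D
eulerian-orientation-of-size zero G D size≡0 _ =
  const true , λ w → trans (netOut-orientation G D (const true) w) (∑ℤ.sum-zero _ (nothing-out w))
  where
  nothing-out : ∀ w e → arcsOut G D (const true) w e ≡ 0ℤ
  nothing-out w e rewrite size≡0⇒empty D size≡0 e = refl
eulerian-orientation-of-size (suc k) G D size≡1+k D-even with size≡suc⇒nonempty D size≡1+k
... | e₁ , D∋e₁ with tail G e₁ ≟ head G e₁
...   | yes loop = orientation-remove-loop G loop
  (eulerian-orientation-of-size k G (remove e₁ D) (ℕP.suc-injective (trans (sym (size-remove D D∋e₁)) size≡1+k))
    (even-remove-loop G loop D-even))
...   | no ¬loop with second-edge-at-tail G D-even D∋e₁ ¬loop
...     | e₂ , e₂≢e₁ , D∋e₂ , e₂∋u =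
  lift (eulerian-orientation-of-size k G′ D′ (ℕP.suc-injective (trans (sym (size-remove D D∋e₂)) size≡1+k))
    (even D-even))
  where open SplitOff G D e₂≢e₁ D∋e₁ D∋e₂ e₂∋u

eulerian-orientation : ∀ {n m} (G : Graph n m) (D : EdgeSet m) → IsEven G D → HasEulerianOrientation G D
eulerian-orientation G D = eulerian-orientation-of-size (size D) G D refl

-- T-joins

module _ {n m : ℕ} (G : Graph n m) where

  walkEdges : ∀ {A x y} → Walk G A x y → EdgeSet m
  walkEdges []          = const false
  walkEdges (fwd e _ W) = (λ i → ⌊ i ≟ e ⌋) △ walkEdges W
  walkEdges (bwd e _ W) = (λ i → ⌊ i ≟ e ⌋) △ walkEdges W

  walkEdges-⊆ : ∀ {A x y} (W : Walk G A x y) e → walkEdges W e ≡ true → A e ≡ true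
  walkEdges-⊆ []          e ()
  walkEdges-⊆ (fwd f A∋f W) e W∋e with e ≟ f
  ... | yes refl = A∋f
  ... | no _     = walkEdges-⊆ W e W∋e
  walkEdges-⊆ (bwd f A∋f W) e W∋e with e ≟ f
  ... | yes refl = A∋f
  ... | no _     = walkEdges-⊆ W e W∋e

  oddDegree-walkEdges : ∀ {A x y} (W : Walk G A x y) w →
    oddDegree G (walkEdges W) w ≡ ⌊ x ≟ w ⌋ xor ⌊ y ≟ w ⌋
  oddDegree-walkEdges {x = x} [] w =
    trans (∑₂.sum-zero (λ e → false ∧ incident G e w) (λ _ → refl)) (sym (xor-same ⌊ x ≟ w ⌋))
  oddDegree-walkEdges {y = y} (fwd e _ W) w =
    trans (oddDegree-toggle G e (walkEdges W) w)
      (trans (cong (incident G e w xor_) (oddDegree-walkEdges W w))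
        (xor-telescope ⌊ tail G e ≟ w ⌋ ⌊ head G e ≟ w ⌋ ⌊ y ≟ w ⌋))
  oddDegree-walkEdges {y = y} (bwd e _ W) w =
    trans (oddDegree-toggle G e (walkEdges W) w)
      (trans (cong₂ _xor_ (xor-comm ⌊ tail G e ≟ w ⌋ ⌊ head G e ≟ w ⌋) (oddDegree-walkEdges W w))
        (xor-telescope ⌊ head G e ≟ w ⌋ ⌊ tail G e ≟ w ⌋ ⌊ y ≟ w ⌋))

HasTJoin : ∀ {n m} → Graph n m → EdgeSet m → (Fin n → Bool) → Set
HasTJoin {m = m} G A T =
  ∃ λ (J : EdgeSet m) → (∀ e → J e ≡ true → A e ≡ true) × (∀ w → oddDegree G J w ≡ T w)

tJoin : ∀ {n m} (G : Graph n m) (A : EdgeSet m) → ConnectedOn G A →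
  (T : Fin n → Bool) → ∑₂.sum T ≡ false → HasTJoin G A T
tJoin {zero}      G A connected T _      = const false , (λ _ ()) , λ ()
tJoin {suc n} {m} G A connected T T-even = J , J⊆A , J-odd
  where
  W : Fin (suc n) → EdgeSet m
  W v = walkEdges G (connected zero v)
  J : EdgeSet m
  J e = ∑₂.sum (λ v → T v ∧ W v e)
  J⊆A : ∀ e → J e ≡ true → A e ≡ true
  J⊆A e J∋e with ∑₂-true⇒∃ (λ v → T v ∧ W v e) J∋e
  ... | v , Tv∧W∋e = walkEdges-⊆ G (connected zero v) e (∧-conicalʳ (T v) (W v e) Tv∧W∋e)
  J-odd : ∀ w → oddDegree G J w ≡ T w
  J-odd w = begin
    ∑₂.sum (λ e → J e ∧ incident G e w)
      ≡⟨ ∑₂.sum-cong-≗ (λ e → ∧-distribʳ-∑₂ (incident G e w) (λ v → T v ∧ W v e)) ⟩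
    ∑₂.sum (λ e → ∑₂.sum (λ v → (T v ∧ W v e) ∧ incident G e w))
      ≡⟨ ∑₂.∑-comm (λ e v → (T v ∧ W v e) ∧ incident G e w) ⟩
    ∑₂.sum (λ v → ∑₂.sum (λ e → (T v ∧ W v e) ∧ incident G e w))
      ≡⟨ ∑₂.sum-cong-≗ (λ v → trans (∑₂.sum-cong-≗ (λ e → ∧-assoc (T v) (W v e) (incident G e w)))
                                    (sym (∧-distribˡ-∑₂ (T v) (λ e → W v e ∧ incident G e w)))) ⟩
    ∑₂.sum (λ v → T v ∧ oddDegree G (W v) w)
      ≡⟨ ∑₂.sum-cong-≗ (λ v → trans (cong (T v ∧_) (oddDegree-walkEdges G (connected zero v) w))
                                    (∧-distribˡ-xor (T v) ⌊ zero ≟ w ⌋ ⌊ v ≟ w ⌋)) ⟩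
    ∑₂.sum (λ v → (T v ∧ ⌊ zero ≟ w ⌋) xor (T v ∧ ⌊ v ≟ w ⌋))
      ≡⟨ ∑₂.∑-distrib-+ (λ v → T v ∧ ⌊ zero ≟ w ⌋) (λ v → T v ∧ ⌊ v ≟ w ⌋) ⟩
    ∑₂.sum (λ v → T v ∧ ⌊ zero ≟ w ⌋) xor ∑₂.sum (λ v → T v ∧ ⌊ v ≟ w ⌋)
      ≡⟨ cong₂ _xor_ (trans (sym (∧-distribʳ-∑₂ ⌊ zero ≟ w ⌋ T)) (cong (_∧ ⌊ zero ≟ w ⌋) T-even)) at-w ⟩
    T w
      ∎
    where
    open ≡-Reasoning
    at-w : ∑₂.sum (λ v → T v ∧ ⌊ v ≟ w ⌋) ≡ T w
    at-w = trans (∑₂.sum-single _ w (λ v v≢w → trans (cong (T v ∧_) (⌊≟⌋-≢ v≢w)) (∧-zeroʳ (T v))))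
                 (trans (cong (T w ∧_) (⌊≟⌋-refl w)) (∧-identityʳ (T w)))

-- Nowhere-zero 4-flows

module _ {n m : ℕ} (G : Graph n m) where

  evenPart : EdgeSet m → (Fin m → ℤ) → (Fin m → Bool) → Fin m → ℤ
  evenPart H φ σ e = φ e -ℤ (if oddSupport H φ e then sgn (σ e) else 0ℤ)

  evenPart-flow : ∀ H φ σ → IsFlow G H φ → IsFlow G (oddSupport H φ) (sgn ∘ σ) → IsFlow G H (evenPart H φ σ)
  evenPart-flow H φ σ φ-flow σ-flow v = begin
    netOut G H z v                                 ≡⟨ ℤP.+-identityʳ _ ⟨
    netOut G H z v +ℤ 0ℤ                           ≡⟨ cong (netOut G H z v +ℤ_) (σ-flow v) ⟨
    netOut G H z v +ℤ netOut G D (sgn ∘ σ) v       ≡⟨ cong (netOut G H z v +ℤ_) (netOut-restrict G H D _ D⊆H v) ⟨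
    netOut G H z v +ℤ netOut G H ε v               ≡⟨ netOut-+ G H z ε v ⟨
    netOut G H (λ e → z e +ℤ ε e) v                ≡⟨ netOut-cong G H (λ e _ → minus-plus (φ e) (ε e)) v ⟩
    netOut G H φ v                                 ≡⟨ φ-flow v ⟩
    0ℤ                                             ∎
    where
    open ≡-Reasoning
    D = oddSupport H φ
    z = evenPart H φ σ
    ε : Fin m → ℤ
    ε e = if D e then sgn (σ e) else 0ℤ
    D⊆H : ∀ e → D e ≡ true → H e ≡ true
    D⊆H e = ∧-conicalˡ (H e) (isOddℤ (φ e))
    minus-plus : ∀ x y → (x -ℤ y) +ℤ y ≡ x
    minus-plus = solve-∀

  evenPart-even : ∀ H φ σ e → H e ≡ true → isOddℤ (evenPart H φ σ e) ≡ false
  evenPart-even H φ σ e H∋e = trans (isOddℤ-- (φ e) _) (parity (isOddℤ (φ e)) refl)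
    where
    parity : ∀ p → isOddℤ (φ e) ≡ p →
      isOddℤ (φ e) xor isOddℤ (if oddSupport H φ e then sgn (σ e) else 0ℤ) ≡ false
    parity true  odd  rewrite H∋e | odd  = cong not (isOddℤ-sgn (σ e))
    parity false even rewrite H∋e | even = refl

  half-flow : ∀ H z → IsFlow G H z → (∀ e → H e ≡ true → isOddℤ (z e) ≡ false) → IsFlow G H (half ∘ z)
  half-flow H z z-flow z-even v = x+x≡0⇒x≡0 _ (begin
    netOut G H (half ∘ z) v +ℤ netOut G H (half ∘ z) v
      ≡⟨ netOut-+ G H (half ∘ z) (half ∘ z) v ⟨
    netOut G H (λ e → half (z e) +ℤ half (z e)) v
      ≡⟨ netOut-cong G H (λ e H∋e → half+half (z e) (z-even e H∋e)) v ⟩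
    netOut G H z v
      ≡⟨ z-flow v ⟩
    0ℤ
      ∎)
    where open ≡-Reasoning

  nowhere-zero-4-flow⇒even-cover : ∀ H → NowhereZeroFlowOn G 4 H →
    ∃ λ D₁ → ∃ λ D₂ → IsEven G D₁ × IsEven G D₂ × (∀ e → H e ≡ true → D₁ e ∨ D₂ e ≡ true)
  nowhere-zero-4-flow⇒even-cover H (φ , bounded , φ-flow) =
    oddSupport H φ , oddSupport H g , D₁-even , oddSupport-even G H g g-flow , covered
    where
    D₁-even = oddSupport-even G H φ φ-flow
    orientation = eulerian-orientation G (oddSupport H φ) D₁-even
    z = evenPart H φ (proj₁ orientation)
    g = half ∘ z
    g-flow : IsFlow G H g
    g-flow = half-flow H z (evenPart-flow H φ _ φ-flow (proj₂ orientation)) (evenPart-even H φ _)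
    covered : ∀ e → H e ≡ true → oddSupport H φ e ∨ oddSupport H g e ≡ true
    covered e H∋e with isOddℤ (φ e) in φ-parity
    ... | true  rewrite H∋e = refl
    ... | false rewrite H∋e | ℤP.+-identityʳ (φ e) =
      isOddℤ-half-±2 (φ e) φ-parity (proj₁ (bounded e H∋e)) (proj₂ (bounded e H∋e))

-- Five cycles

covered-twice : ∀ c d₁ d₂ j → (c ≡ true → j ≡ false) → (c ≡ false → d₁ ∨ d₂ ≡ true) →
  let x = (c ∧ not (d₁ ∨ d₂)) xor j
      count = λ (b : Bool) → if b then 1 else 0
  in count c ℕ.+ (count (x xor ((d₁ xor d₂) xor c)) ℕ.+ (count (x xor (d₁ xor c))
       ℕ.+ (count (x xor (d₂ xor c)) ℕ.+ (count x ℕ.+ 0)))) ≡ 2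
covered-twice true  true  true  false _ _ = refl
covered-twice true  true  false false _ _ = refl
covered-twice true  false true  false _ _ = refl
covered-twice true  false false false _ _ = refl
covered-twice true  _     _     true  C∌j _ = contradiction (C∌j refl) λ ()
covered-twice false true  true  true  _ _ = refl
covered-twice false true  true  false _ _ = refl
covered-twice false true  false true  _ _ = refl
covered-twice false true  false false _ _ = refl
covered-twice false false true  true  _ _ = refl
covered-twice false false true  false _ _ = refl
covered-twice false false false _     _ uncovered = contradiction (uncovered refl) λ ()

module _ {n m : ℕ} (G : Graph n m) where

  five-cdc-from-even-cover : ∀ {C D₁ D₂} → IsEven G C → ConnectedOn G (minus G C) →
    IsEven G D₁ → IsEven G D₂ → (∀ e → C e ≡ false → D₁ e ∨ D₂ e ≡ true) →
    ∃ λ (𝒮 : Fin 5 → EdgeSet m) → IsCDC G 5 𝒮 × (∃ λ i → ∀ e → 𝒮 i e ≡ C e)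
  five-cdc-from-even-cover {C} {D₁} {D₂} C-even G-C-connected D₁-even D₂-even covers =
    𝒮 , (cycles , covered) , zero , (λ _ → refl)
    where
    U : EdgeSet m
    U e = C e ∧ not (D₁ e ∨ D₂ e)
    join = tJoin G (minus G C) G-C-connected (oddDegree G U) (handshake G U)
    J : EdgeSet m
    J = proj₁ join
    X : EdgeSet m
    X = U △ J
    X-even : IsEven G X
    X-even w = trans (oddDegree-△ G U J w)
      (trans (cong (oddDegree G U w xor_) (proj₂ (proj₂ join) w)) (xor-same (oddDegree G U w)))
    𝒮 : Fin 5 → EdgeSet m
    𝒮 = C ∷ X △ ((D₁ △ D₂) △ C) ∷ X △ (D₁ △ C) ∷ X △ (D₂ △ C) ∷ X ∷ Vector.[]
    cycles : ∀ i → IsCycle G (𝒮 i)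
    cycles zero                      = even⇒cycle G C-even
    cycles (suc zero)                = even⇒cycle G (even-△ G X-even (even-△ G (even-△ G D₁-even D₂-even) C-even))
    cycles (suc (suc zero))          = even⇒cycle G (even-△ G X-even (even-△ G D₁-even C-even))
    cycles (suc (suc (suc zero)))    = even⇒cycle G (even-△ G X-even (even-△ G D₂-even C-even))
    cycles (suc (suc (suc (suc zero)))) = even⇒cycle G X-even
    J-avoids-C : ∀ e → C e ≡ true → J e ≡ false
    J-avoids-C e C∋e = ¬-not (λ J∋e → contradiction (trans (sym (proj₁ (proj₂ join) e J∋e)) (cong not C∋e)) λ ())
    covered : ∀ e → sumℕ 5 (λ i → if 𝒮 i e then 1 else 0) ≡ 2
    covered e = covered-twice (C e) (D₁ e) (D₂ e) (J e) (J-avoids-C e) (covers e)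

theorem3p2 : {n m : ℕ} (G : Graph n m) (C M : EdgeSet m) →
    TwoEdgeConnected G →
    NonSeparatingCycle G C →
    (∀ e → M e ≡ true → C e ≡ true) →
    NowhereZeroFlowOn G 4 (minus G M) →
    ∃ λ (𝒮 : Fin 5 → EdgeSet m) → IsCDC G 5 𝒮 × (∃ λ i → ∀ e → 𝒮 i e ≡ C e)
theorem3p2 G C M _ (C-cycle , G-C-connected) M⊆C flow
  with nowhere-zero-4-flow⇒even-cover G (minus G M) flow
... | D₁ , D₂ , D₁-even , D₂-even , covers =
  five-cdc-from-even-cover G (cycle⇒even G C-cycle) G-C-connected D₁-even D₂-even
    (λ e C∌e → covers e (off-C⇒in-G-M e C∌e))
  where
  off-C⇒in-G-M : ∀ e → C e ≡ false → minus G M e ≡ true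
  off-C⇒in-G-M e C∌e = cong not (¬-not (λ M∋e → contradiction (trans (sym (M⊆C e M∋e)) C∌e) λ ()))
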